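{- Let $m\ge 2$ and $n\ge 1$ be integers. The determining number of the Hamming graph $K_m^{\Box n}$ (the Cartesian product of $n$ copies of the complete graph $K_m$) is the smallest integer $r$ for which $n\le S(r,m)+S(r,m-1)$.
   Context: $S(r,m)$ denotes the Stirling number of the second kind, the number of partitions of $[r]=\{1,\dots,r\}$ into $m$ nonempty unlabeled parts. A set $S$ of vertices of a graph $G$ is a determining set if the only automorphism of $G$ fixing every vertex of $S$ is the identity; the determining number $\det(G)$ is the minimum size of a determining set. -}

module Defs where

open import Data.Nat using (ℕ; zero; suc; _+_; _*_; _≤_; _<_)
open import Data.Fin using (Fin)
open import Data.Fin.Properties using (_≟_)
open import Data.Vec using (Vec; []; _∷_)
open import Data.List using (List; length)
open import Data.List.Membership.Propositional using (_∈_)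
open import Data.List.Relation.Unary.Unique.Propositional using (Unique)
open import Data.Product using (Σ; _×_)
open import Relation.Binary.PropositionalEquality using (_≡_)
open import Relation.Nullary using (¬_; yes; no)
open import Function.Bundles using (_⇔_)

Stirling2 : ℕ → ℕ → ℕ
Stirling2 zero zero = 1
Stirling2 zero (suc k) = 0
Stirling2 (suc r) zero = 0
Stirling2 (suc r) (suc k) = suc k * Stirling2 r (suc k) + Stirling2 r k

record Graph : Set₁ where
  field
    Vertex : Set
    Adj    : Vertex → Vertex → Set
open Graph public

record Automorphism (G : Graph) : Set where
  field
    fun     : Vertex G → Vertex G
    inv     : Vertex G → Vertex G
    inv-l   : ∀ x → inv (fun x) ≡ x
    inv-r   : ∀ x → fun (inv x) ≡ x
    adj-iff : ∀ x y → Adj G x y ⇔ Adj G (fun x) (fun y)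
open Automorphism public

-- A finite set of vertices is represented by a duplicate-free list;
-- its size is the length of the list.
IsDeterminingSet : (G : Graph) → List (Vertex G) → Set
IsDeterminingSet G S =
  (φ : Automorphism G) → (∀ v → v ∈ S → fun φ v ≡ v) → ∀ x → fun φ x ≡ x

IsDeterminingNumber : Graph → ℕ → Set
IsDeterminingNumber G d =
  Σ (List (Vertex G)) (λ S → Unique S × IsDeterminingSet G S × length S ≡ d)
  × ((S : List (Vertex G)) → Unique S → IsDeterminingSet G S → d ≤ length S)

hdist : ∀ {m n} → Vec (Fin m) n → Vec (Fin m) n → ℕ
hdist [] [] = 0
hdist (a ∷ xs) (b ∷ ys) with a ≟ b
... | yes _ = hdist xs ys
... | no  _ = suc (hdist xs ys)

-- The Hamming graph K_m^{□n}: vertices are n-tuples over an m-set,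
-- adjacent iff they differ in exactly one coordinate
-- (this is exactly the Cartesian product of n copies of K_m).
Hamming : ℕ → ℕ → Graph
Hamming m n = record { Vertex = Vec (Fin m) n ; Adj = λ x y → hdist x y ≡ 1 }

-- A list S of words is determining exactly when (i) no two coordinates induce the same
-- partition of S, and (ii) in every coordinate at most one symbol is missing from S.
-- If (i) fails, swapping the two coordinates and relabelling symbols fixes S; if (ii) fails,
-- exchanging the two missing symbols in that coordinate does.  Conversely, an automorphism
-- fixing S and a word s ∈ S maps each line {s [ j ]≔ p} through s onto a line through s;
-- comparing distances from S to the two lines, (i) forces the same line and (ii) the
-- identity on it, and a vertex is determined by its distances to the lines through s.
-- Recording the partition induced by a coordinate as a restricted growth string, (i) and (ii)
-- say the n coordinates give n distinct strings of length |S| with m or m − 1 blocks, so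
-- n ≤ S(|S|, m) + S(|S|, m − 1); conversely any n such strings, used as columns, form a list
-- satisfying (i) and (ii).

module Submission where

open import Defs
open import Data.Nat using (ℕ; zero; suc; _+_; _*_; _∸_; _≤_; _<_; z≤n; s≤s; s≤s⁻¹; _<?_)
import Data.Nat as ℕ
open import Data.Nat.Properties
  using ( ≤-refl; ≤-reflexive; ≤-trans; ≤-antisym; ≤∧≢⇒<; ≮⇒≥; <-irrefl; <-cmp; n≤1+n; m<n⇒m<1+n; n<1+n
        ; m≤n⇒m<n∨m≡n; n≤0⇒n≡0; +-mono-≤; +-assoc; +-identityʳ; +-cancelˡ-≡; +-cancelʳ-≡
        ; m+n≡0⇒m≡0; m+n≡0⇒n≡0; suc-injective; *-suc; *-zeroʳ; module ≤-Reasoning)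
open import Data.Nat.Solver using (module +-*-Solver)
open import Data.Fin using (Fin; zero; suc; toℕ; fromℕ<; inject≤; punchIn)
open import Data.Fin.Properties
  using ( _≟_; any?; injective⇒≤; toℕ-injective; toℕ<n; toℕ-fromℕ<; inject≤-injective
        ; punchIn-injective; punchInᵢ≢i)
open import Data.Fin.Permutation using (Permutation′; _⟨$⟩ʳ_; _⟨$⟩ˡ_; inverseˡ; inverseʳ; _∘ₚ_; transpose)
import Data.Fin.Permutation as Perm
import Data.Fin.Permutation.Components as PC
open import Data.Vec using (Vec; []; _∷_; lookup; tabulate; replicate; _[_]≔_)
open import Data.Vec.Properties
  using ( ∷-injectiveˡ; ∷-injectiveʳ; tabulate∘lookup; tabulate-cong; lookup∘tabulate; lookup-replicate
        ; lookup∘update; lookup∘update′; []≔-lookup; []≔-idempotent; ≡-dec)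
open import Data.List using (List; []; _∷_; map; _++_; length; downFrom; deduplicate)
import Data.List as List
open import Data.List.Properties using (length-++; length-map; length-downFrom; length-tabulate; length-deduplicate)
open import Data.List.Membership.Propositional using (_∈_)
open import Data.List.Membership.Propositional.Properties
  using ( ∈-++⁺ˡ; ∈-++⁺ʳ; ∈-++⁻; ∈-map⁺; ∈-map⁻; ∈-downFrom⁺; ∈-downFrom⁻; ∈-lookup
        ; ∈-tabulate⁺; ∈-deduplicate⁺)
open import Data.List.Relation.Unary.Any using (here; there; index)
open import Data.List.Relation.Unary.Any.Properties using (lookup-index)
import Data.List.Relation.Unary.All as All
open import Data.List.Relation.Unary.AllPairs using ([]; _∷_)
open import Data.List.Relation.Unary.Unique.Propositional using (Unique)
import Data.List.Relation.Unary.Unique.Propositional.Properties as Unique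
import Data.List.Relation.Unary.Unique.DecPropositional.Properties as DecUnique
open import Data.Product using (∃; ∃-syntax; _×_; _,_; proj₁; proj₂)
open import Data.Sum using (_⊎_; inj₁; inj₂)
open import Function.Base using (_∘_; id)
open import Function.Bundles using (_⇔_; mk⇔; Equivalence)
open import Function.Definitions using (Injective)
open import Relation.Binary.Definitions using (DecidableEquality; tri<; tri≈; tri>)
open import Relation.Nullary using (¬_; yes; no)
open import Relation.Nullary.Decidable using (¬?)
open import Relation.Nullary.Negation using (contradiction)
open import Relation.Binary.PropositionalEquality

open +-*-Solver using (solve; _:+_; _:=_)

private
  variable
    k k′ m n s : ℕ

vec-ext : {A : Set} {x y : Vec A n} → (∀ i → lookup x i ≡ lookup y i) → x ≡ y
vec-ext {x = x} {y} eq = trans (sym (tabulate∘lookup x)) (trans (tabulate-cong eq) (tabulate∘lookup y))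

another : {m : ℕ} (a : Fin (suc (suc m))) → ∃[ c ] c ≢ a
another a = punchIn a zero , punchInᵢ≢i a zero

δ : Fin m → Fin m → ℕ
δ a b with a ≟ b
... | yes _ = 0
... | no  _ = 1

δ-refl : (a : Fin m) → δ a a ≡ 0
δ-refl a with a ≟ a
... | yes _  = refl
... | no a≢a = contradiction refl a≢a

δ-≢ : {a b : Fin m} → a ≢ b → δ a b ≡ 1
δ-≢ {a = a} {b} a≢b with a ≟ b
... | yes a≡b = contradiction a≡b a≢b
... | no  _   = refl

δ≡0⇒≡ : {a b : Fin m} → δ a b ≡ 0 → a ≡ b
δ≡0⇒≡ {a = a} {b} δ≡0 with a ≟ b
... | yes a≡b = a≡b

δ≤1 : (a b : Fin m) → δ a b ≤ 1
δ≤1 a b with a ≟ b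
... | yes _ = z≤n
... | no  _ = s≤s z≤n

δ-triangle : (a b c : Fin m) → δ a c ≤ δ a b + δ b c
δ-triangle a b c with a ≟ c
... | yes _ = z≤n
... | no a≢c with a ≟ b
...   | yes refl = ≤-reflexive (sym (δ-≢ a≢c))
...   | no  _    = s≤s z≤n

hdist-∷ : (a b : Fin m) (x y : Vec (Fin m) n) → hdist (a ∷ x) (b ∷ y) ≡ δ a b + hdist x y
hdist-∷ a b x y with a ≟ b
... | yes _ = refl
... | no  _ = refl

hdist-refl : (x : Vec (Fin m) n) → hdist x x ≡ 0
hdist-refl []      = refl
hdist-refl (a ∷ x) = begin
  hdist (a ∷ x) (a ∷ x)  ≡⟨ hdist-∷ a a x x ⟩
  δ a a + hdist x x      ≡⟨ cong₂ _+_ (δ-refl a) (hdist-refl x) ⟩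
  0                      ∎
  where open ≡-Reasoning

hdist≡0⇒≡ : (x y : Vec (Fin m) n) → hdist x y ≡ 0 → x ≡ y
hdist≡0⇒≡ []      []      _  = refl
hdist≡0⇒≡ (a ∷ x) (b ∷ y) eq rewrite hdist-∷ a b x y =
  cong₂ _∷_ (δ≡0⇒≡ (m+n≡0⇒m≡0 _ eq)) (hdist≡0⇒≡ x y (m+n≡0⇒n≡0 (δ a b) eq))

hdist-triangle : (x y z : Vec (Fin m) n) → hdist x z ≤ hdist x y + hdist y z
hdist-triangle []      []      []      = z≤n
hdist-triangle (a ∷ x) (b ∷ y) (c ∷ z)
  rewrite hdist-∷ a c x z | hdist-∷ a b x y | hdist-∷ b c y z = begin
    δ a c + hdist x z                          ≤⟨ +-mono-≤ (δ-triangle a b c) (hdist-triangle x y z) ⟩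
    (δ a b + δ b c) + (hdist x y + hdist y z)  ≡⟨ interchange (δ a b) (δ b c) (hdist x y) (hdist y z) ⟩
    (δ a b + hdist x y) + (δ b c + hdist y z)  ∎
  where
  open ≤-Reasoning
  interchange : ∀ p q r s → (p + q) + (r + s) ≡ (p + r) + (q + s)
  interchange = solve 4 (λ p q r s → (p :+ q) :+ (r :+ s) := (p :+ r) :+ (q :+ s)) refl

hdist-update : (x y : Vec (Fin m) n) (i : Fin n) (u w : Fin m) →
  hdist (x [ i ]≔ u) (y [ i ]≔ w) + δ (lookup x i) (lookup y i) ≡ hdist x y + δ u w
hdist-update (a ∷ x) (b ∷ y) zero u w
  rewrite hdist-∷ u w x y | hdist-∷ a b x y = swap (δ u w) (hdist x y) (δ a b)
  where
  swap : ∀ p q r → (p + q) + r ≡ (r + q) + p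
  swap = solve 3 (λ p q r → (p :+ q) :+ r := (r :+ q) :+ p) refl
hdist-update (a ∷ x) (b ∷ y) (suc i) u w
  rewrite hdist-∷ a b (x [ i ]≔ u) (y [ i ]≔ w) | hdist-∷ a b x y = begin
    δ a b + hdist (x [ i ]≔ u) (y [ i ]≔ w) + δ (lookup x i) (lookup y i)
      ≡⟨ +-assoc (δ a b) _ _ ⟩
    δ a b + (hdist (x [ i ]≔ u) (y [ i ]≔ w) + δ (lookup x i) (lookup y i))
      ≡⟨ cong (δ a b +_) (hdist-update x y i u w) ⟩
    δ a b + (hdist x y + δ u w)
      ≡⟨ sym (+-assoc (δ a b) _ _) ⟩
    δ a b + hdist x y + δ u w ∎
  where open ≡-Reasoning

hdist-to-line : (x s : Vec (Fin m) n) (i : Fin n) (a : Fin m) →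
  hdist x (s [ i ]≔ a) + δ (lookup x i) (lookup s i) ≡ hdist x s + δ (lookup x i) a
hdist-to-line x s i a =
  subst (λ x′ → hdist x′ (s [ i ]≔ a) + δ (lookup x i) (lookup s i) ≡ hdist x s + δ (lookup x i) a)
        ([]≔-lookup x i) (hdist-update x s i (lookup x i) a)

hdist-same-line : (s : Vec (Fin m) n) (i : Fin n) (a b : Fin m) →
  hdist (s [ i ]≔ a) (s [ i ]≔ b) ≡ δ a b
hdist-same-line s i a b = +-cancelʳ-≡ _ _ _ (begin
  hdist (s [ i ]≔ a) (s [ i ]≔ b) + δ (lookup s i) (lookup s i)  ≡⟨ hdist-update s s i a b ⟩
  hdist s s + δ a b                                              ≡⟨ cong (_+ δ a b) (hdist-refl s) ⟩
  δ a b                                                          ≡⟨ sym (+-identityʳ (δ a b)) ⟩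
  δ a b + 0                                                      ≡⟨ cong (δ a b +_) (sym (δ-refl (lookup s i))) ⟩
  δ a b + δ (lookup s i) (lookup s i)                            ∎)
  where open ≡-Reasoning

hdist-to-neighbour : (s : Vec (Fin m) n) (i : Fin n) (a : Fin m) →
  hdist s (s [ i ]≔ a) ≡ δ (lookup s i) a
hdist-to-neighbour s i a =
  subst (λ s′ → hdist s′ (s [ i ]≔ a) ≡ δ (lookup s i) a) ([]≔-lookup s i)
        (hdist-same-line s i (lookup s i) a)

hdist-distinct-lines : (s : Vec (Fin m) n) {i j : Fin n} {a b : Fin m} → i ≢ j →
  a ≢ lookup s i → b ≢ lookup s j → hdist (s [ i ]≔ a) (s [ j ]≔ b) ≡ 2
hdist-distinct-lines {m = m} {n = n} s {i} {j} {a} {b} i≢j a≢sᵢ b≢sⱼ = +-cancelʳ-≡ _ _ _ (begin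
  hdist x (s [ j ]≔ b) + δ (lookup x j) (lookup s j)  ≡⟨ hdist-to-line x s j b ⟩
  hdist x s + δ (lookup x j) b                        ≡⟨ cong₂ _+_ x-to-s (δ-≢ xⱼ≢b) ⟩
  2                                                   ≡⟨ cong (2 +_) (sym xⱼ-to-sⱼ) ⟩
  2 + δ (lookup x j) (lookup s j)                     ∎)
  where
  open ≡-Reasoning
  x : Vec (Fin m) n
  x = s [ i ]≔ a
  xⱼ≡sⱼ : lookup x j ≡ lookup s j
  xⱼ≡sⱼ = lookup∘update′ (i≢j ∘ sym) s a
  xⱼ-to-sⱼ : δ (lookup x j) (lookup s j) ≡ 0
  xⱼ-to-sⱼ = trans (cong (λ c → δ c (lookup s j)) xⱼ≡sⱼ) (δ-refl (lookup s j))
  xⱼ≢b : lookup x j ≢ b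
  xⱼ≢b xⱼ≡b = b≢sⱼ (trans (sym xⱼ≡b) xⱼ≡sⱼ)
  x-to-s : hdist x s ≡ 1
  x-to-s = trans (subst (λ s′ → hdist x s′ ≡ δ a (lookup s i)) ([]≔-lookup s i)
                        (hdist-same-line s i a (lookup s i)))
                 (δ-≢ a≢sᵢ)

hdist≡1⇒neighbour : (s y : Vec (Fin m) n) → hdist s y ≡ 1 →
  ∃[ k ] ∃[ b ] b ≢ lookup s k × y ≡ s [ k ]≔ b
hdist≡1⇒neighbour []      []      ()
hdist≡1⇒neighbour (a ∷ s) (c ∷ y) eq with a ≟ c
... | yes refl with hdist≡1⇒neighbour s y eq
...   | k , b , b≢sₖ , refl = suc k , b , b≢sₖ , refl
hdist≡1⇒neighbour (a ∷ s) (c ∷ y) eq | no a≢c =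
  zero , c , a≢c ∘ sym , cong (c ∷_) (sym (hdist≡0⇒≡ s y (suc-injective eq)))

hdist-step : (x y : Vec (Fin m) n) (d : ℕ) → hdist x y ≡ suc d →
  ∃[ z ] hdist x z ≡ 1 × hdist z y ≡ d
hdist-step []      []      d ()
hdist-step (a ∷ x) (b ∷ y) d eq with a ≟ b
... | yes refl with hdist-step x y d eq
...   | z , x-z , z-y = a ∷ z , trans (hdist-∷ a a x z) (cong₂ _+_ (δ-refl a) x-z)
                              , trans (hdist-∷ a a z y) (cong₂ _+_ (δ-refl a) z-y)
hdist-step (a ∷ x) (b ∷ y) d eq | no a≢b =
  b ∷ x , trans (hdist-∷ a b x x) (cong₂ _+_ (δ-≢ a≢b) (hdist-refl x))
        , trans (hdist-∷ b b x y) (cong₂ _+_ (δ-refl b) (suc-injective eq))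

neighbours-close⇒same-line : (s : Vec (Fin m) n) {i j : Fin n} {a b : Fin m} →
  a ≢ lookup s i → b ≢ lookup s j → hdist (s [ i ]≔ a) (s [ j ]≔ b) ≤ 1 → i ≡ j
neighbours-close⇒same-line s {i} {j} a≢sᵢ b≢sⱼ close with i ≟ j
... | yes i≡j = i≡j
... | no  i≢j = contradiction (subst (_≤ 1) (hdist-distinct-lines s i≢j a≢sᵢ b≢sⱼ) close) λ { (s≤s ()) }

-- Automorphisms are isometries

PreservesAdjacency : (Vec (Fin m) n → Vec (Fin m) n) → Set
PreservesAdjacency f = ∀ x y → hdist x y ≡ 1 → hdist (f x) (f y) ≡ 1

hdist-contracting : (f : Vec (Fin m) n → Vec (Fin m) n) → PreservesAdjacency f →
  ∀ x y → hdist (f x) (f y) ≤ hdist x y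
hdist-contracting f f-adj x y = bound (hdist x y) x y refl
  where
  bound : ∀ d x y → hdist x y ≡ d → hdist (f x) (f y) ≤ d
  bound zero x y eq rewrite hdist≡0⇒≡ x y eq | hdist-refl (f y) = z≤n
  bound (suc d) x y eq with hdist-step x y d eq
  ... | z , x-z , z-y = ≤-trans (hdist-triangle (f x) (f z) (f y))
                                 (+-mono-≤ (≤-reflexive (f-adj x z x-z)) (bound d z y z-y))

automorphism-isometry : (φ : Automorphism (Hamming m n)) →
  ∀ x y → hdist (fun φ x) (fun φ y) ≡ hdist x y
automorphism-isometry φ x y = ≤-antisym
  (hdist-contracting (fun φ) (λ x y → Equivalence.to (adj-iff φ x y)) x y)
  (subst₂ (λ x′ y′ → hdist x′ y′ ≤ hdist (fun φ x) (fun φ y)) (inv-l φ x) (inv-l φ y)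
          (hdist-contracting (inv φ) inv-adj (fun φ x) (fun φ y)))
  where
  inv-adj : PreservesAdjacency (inv φ)
  inv-adj x y x-y = Equivalence.from (adj-iff φ (inv φ x) (inv φ y))
    (subst₂ (λ x′ y′ → hdist x′ y′ ≡ 1) (sym (inv-r φ x)) (sym (inv-r φ y)) x-y)

SameKernel : {I A B : Set} → (I → A) → (I → B) → Set
SameKernel f g = ∀ t t′ → f t ≡ f t′ ⇔ g t ≡ g t′

same-kernel-trans : {I A B C : Set} {f : I → A} {g : I → B} {h : I → C} →
  SameKernel f g → SameKernel g h → SameKernel f h
same-kernel-trans f~g g~h t t′ = mk⇔
  (Equivalence.to (g~h t t′) ∘ Equivalence.to (f~g t t′))
  (Equivalence.from (f~g t t′) ∘ Equivalence.from (g~h t t′))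

same-kernel-sym : {I A B : Set} {f : I → A} {g : I → B} → SameKernel f g → SameKernel g f
same-kernel-sym f~g t t′ = mk⇔ (Equivalence.from (f~g t t′)) (Equivalence.to (f~g t t′))

column : (S : List (Vec (Fin m) n)) → Fin n → Fin (length S) → Fin m
column S j t = lookup (List.lookup S t) j

ColumnsAgree : List (Vec (Fin m) n) → Fin n → Fin n → Set
ColumnsAgree S j k = ∀ {u v} → u ∈ S → v ∈ S → lookup u j ≡ lookup v j ⇔ lookup u k ≡ lookup v k

Misses : List (Vec (Fin m) n) → Fin n → Fin m → Set
Misses S j a = ∀ {u} → u ∈ S → lookup u j ≢ a

SeparatesColumns : List (Vec (Fin m) n) → Set
SeparatesColumns S = ∀ j k → ColumnsAgree S j k → j ≡ k

MissesAtMostOneSymbol : List (Vec (Fin m) n) → Set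
MissesAtMostOneSymbol S = ∀ j a b → Misses S j a → Misses S j b → a ≡ b

columns-agree⇒same-kernel : (S : List (Vec (Fin m) n)) {j k : Fin n} →
  ColumnsAgree S j k → SameKernel (column S j) (column S k)
columns-agree⇒same-kernel S agree t t′ = agree (∈-lookup t) (∈-lookup t′)

same-kernel⇒columns-agree : (S : List (Vec (Fin m) n)) {j k : Fin n} →
  SameKernel (column S j) (column S k) → ColumnsAgree S j k
same-kernel⇒columns-agree S kernel u∈S v∈S
  rewrite lookup-index u∈S | lookup-index v∈S = kernel (index u∈S) (index v∈S)

misses≤1⇒column-misses≤1 : (S : List (Vec (Fin m) n)) → MissesAtMostOneSymbol S →
  ∀ j a b → (∀ t → column S j t ≢ a) → (∀ t → column S j t ≢ b) → a ≡ b
misses≤1⇒column-misses≤1 S misses≤1 j a b misses-a misses-b =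
  misses≤1 j a b (on-members misses-a) (on-members misses-b)
  where
  on-members : ∀ {c} → (∀ t → column S j t ≢ c) → Misses S j c
  on-members misses u∈S rewrite lookup-index u∈S = misses (index u∈S)

relabelling⇒columns-agree : {S : List (Vec (Fin m) n)} {j k : Fin n} (g : Fin m → Fin m) →
  (∀ {u} → u ∈ S → ∀ p → lookup u j ≡ p ⇔ lookup u k ≡ g p) → ColumnsAgree S j k
relabelling⇒columns-agree {S = S} {j} {k} g relabelled u∈S v∈S = mk⇔
  (λ uⱼ≡vⱼ → trans (uₖ≡g-uⱼ u∈S) (sym (Equivalence.to (relabelled v∈S _) (sym uⱼ≡vⱼ))))
  (λ uₖ≡vₖ → sym (Equivalence.from (relabelled v∈S _) (trans (sym uₖ≡vₖ) (uₖ≡g-uⱼ u∈S))))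
  where
  uₖ≡g-uⱼ : ∀ {u} → u ∈ S → lookup u k ≡ g (lookup u j)
  uₖ≡g-uⱼ u∈S = Equivalence.to (relabelled u∈S _) refl

-- Sufficiency of the column conditions

δ-gap : {a b c : Fin m} (C : ℕ) → δ a c + C ≡ suc (δ a b + C) → a ≡ b
δ-gap {a = a} {b} {c} C eq =
  δ≡0⇒≡ (n≤0⇒n≡0 (s≤s⁻¹ (subst (_≤ 1) (+-cancelʳ-≡ C _ _ eq) (δ≤1 a c))))

δ-offset⇒relabelling : {m : ℕ} {x y : Fin (suc (suc m))} {A B : ℕ}
  (g : Fin (suc (suc m)) → Fin (suc (suc m))) → Injective _≡_ _≡_ g → (∀ p → δ x p + B ≡ δ y (g p) + A) → ∀ p → x ≡ p ⇔ y ≡ g p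
δ-offset⇒relabelling {x = x} {y} {A} {B} g g-inj offset p with another p
... | q , q≢p = mk⇔ to from
  where
  open ≡-Reasoning
  to : x ≡ p → y ≡ g p
  to refl = δ-gap A (begin
    δ y (g q) + A        ≡⟨ sym (offset q) ⟩
    δ x q + B            ≡⟨ cong (_+ B) (δ-≢ (q≢p ∘ sym)) ⟩
    suc B                ≡⟨ cong suc (trans (cong (_+ B) (sym (δ-refl x))) (offset x)) ⟩
    suc (δ y (g x) + A)  ∎)
  from : y ≡ g p → x ≡ p
  from refl = δ-gap B (begin
    δ x q + B            ≡⟨ offset q ⟩
    δ (g p) (g q) + A    ≡⟨ cong (_+ A) (δ-≢ (q≢p ∘ sym ∘ g-inj)) ⟩
    suc A                ≡⟨ cong suc (trans (cong (_+ A) (sym (δ-refl (g p)))) (sym (offset p))) ⟩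
    suc (δ x p + B)      ∎)

cross-cancel : ∀ {D H A B X Y} → D + A ≡ H + X → D + B ≡ H + Y → X + B ≡ Y + A
cross-cancel {D} {H} {A} {B} {X} {Y} eqˣ eqʸ = +-cancelˡ-≡ H _ _ (begin
  H + (X + B)  ≡⟨ sym (+-assoc H X B) ⟩
  H + X + B    ≡⟨ cong (_+ B) (sym eqˣ) ⟩
  D + A + B    ≡⟨ swap D A B ⟩
  D + B + A    ≡⟨ cong (_+ A) eqʸ ⟩
  H + Y + A    ≡⟨ +-assoc H Y A ⟩
  H + (Y + A)  ∎)
  where
  open ≡-Reasoning
  swap : ∀ d a b → d + a + b ≡ d + b + a
  swap = solve 3 (λ d a b → d :+ a :+ b := d :+ b :+ a) refl

line-distances⇒relabelling : {m : ℕ} (x y s : Vec (Fin (suc (suc m))) n) (j k : Fin n)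
  (g : Fin (suc (suc m)) → Fin (suc (suc m))) → Injective _≡_ _≡_ g → g (lookup s j) ≡ lookup s k →
  (∀ p → hdist x (s [ j ]≔ p) ≡ hdist y (s [ k ]≔ g p)) →
  ∀ p → lookup x j ≡ p ⇔ lookup y k ≡ g p
line-distances⇒relabelling x y s j k g g-inj gsⱼ≡sₖ same-distances =
  δ-offset⇒relabelling g g-inj offset
  where
  open ≡-Reasoning
  same-distance-to-s : hdist x s ≡ hdist y s
  same-distance-to-s = begin
    hdist x s                            ≡⟨ cong (hdist x) (sym ([]≔-lookup s j)) ⟩
    hdist x (s [ j ]≔ lookup s j)        ≡⟨ same-distances (lookup s j) ⟩
    hdist y (s [ k ]≔ g (lookup s j))    ≡⟨ cong (λ b → hdist y (s [ k ]≔ b)) gsⱼ≡sₖ ⟩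
    hdist y (s [ k ]≔ lookup s k)        ≡⟨ cong (hdist y) ([]≔-lookup s k) ⟩
    hdist y s                            ∎
  offset : ∀ p → δ (lookup x j) p + δ (lookup y k) (lookup s k)
                 ≡ δ (lookup y k) (g p) + δ (lookup x j) (lookup s j)
  offset p = cross-cancel {D = hdist x (s [ j ]≔ p)} {H = hdist x s}
    (hdist-to-line x s j p)
    (begin
      hdist x (s [ j ]≔ p) + δ (lookup y k) (lookup s k)
        ≡⟨ cong (_+ δ (lookup y k) (lookup s k)) (same-distances p) ⟩
      hdist y (s [ k ]≔ g p) + δ (lookup y k) (lookup s k)
        ≡⟨ hdist-to-line y s k (g p) ⟩
      hdist y s + δ (lookup y k) (g p)
        ≡⟨ cong (_+ δ (lookup y k) (g p)) (sym same-distance-to-s) ⟩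
      hdist x s + δ (lookup y k) (g p) ∎)

module _ {m : ℕ} {S : List (Vec (Fin (suc (suc m))) n)} {s : Vec (Fin (suc (suc m))) n}
         (s∈S : s ∈ S) (separates : SeparatesColumns S) (misses≤1 : MissesAtMostOneSymbol S) where

  private
    M : ℕ
    M = suc (suc m)

  separating⇒determining : IsDeterminingSet (Hamming M n) S
  separating⇒determining φ fixes x = vec-ext λ i →
    Equivalence.to (line-distances⇒relabelling x (f x) s i i id id refl (distances-kept x i) (lookup x i)) refl
    where
    f : Vec (Fin M) n → Vec (Fin M) n
    f = fun φ
    f-inj : Injective _≡_ _≡_ f
    f-inj {x} {y} fx≡fy = trans (sym (inv-l φ x)) (trans (cong (inv φ) fx≡fy) (inv-l φ y))
    fs≡s : f s ≡ s
    fs≡s = fixes s s∈S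
    open ≡-Reasoning

    neighbour-image : ∀ {j a} → a ≢ lookup s j →
      ∃[ k ] ∃[ b ] b ≢ lookup s k × f (s [ j ]≔ a) ≡ s [ k ]≔ b
    neighbour-image {j} {a} a≢sⱼ = hdist≡1⇒neighbour s (f (s [ j ]≔ a)) (begin
      hdist s (f (s [ j ]≔ a))      ≡⟨ cong (λ s′ → hdist s′ (f (s [ j ]≔ a))) (sym fs≡s) ⟩
      hdist (f s) (f (s [ j ]≔ a))  ≡⟨ automorphism-isometry φ s _ ⟩
      hdist s (s [ j ]≔ a)          ≡⟨ hdist-to-neighbour s j a ⟩
      δ (lookup s j) a              ≡⟨ δ-≢ (a≢sⱼ ∘ sym) ⟩
      1                             ∎)

    -- Neighbours of s on distinct lines are at distance 2, so one line is mapped into one line.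
    line-image : ∀ j → ∃[ k ] ∀ p → f (s [ j ]≔ p) ≡ s [ k ]≔ lookup (f (s [ j ]≔ p)) k
    line-image j with neighbour-image (proj₂ (another (lookup s j)))
    ... | k , b₀ , b₀≢sₖ , fa₀≡ = k , on-line
      where
      on-line : ∀ p → f (s [ j ]≔ p) ≡ s [ k ]≔ lookup (f (s [ j ]≔ p)) k
      on-line p with p ≟ lookup s j
      ... | yes refl = trans fsⱼ≡s (sym (trans (cong (λ y → s [ k ]≔ lookup y k) fsⱼ≡s) ([]≔-lookup s k)))
        where
        fsⱼ≡s : f (s [ j ]≔ lookup s j) ≡ s
        fsⱼ≡s = trans (cong f ([]≔-lookup s j)) fs≡s
      ... | no p≢sⱼ with neighbour-image p≢sⱼ
      ...   | k′ , b , b≢sₖ′ , fp≡ with neighbours-close⇒same-line s b≢sₖ′ b₀≢sₖ close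
        where
        close : hdist (s [ k′ ]≔ b) (s [ k ]≔ b₀) ≤ 1
        close = subst (_≤ 1) (trans (sym (automorphism-isometry φ _ _)) (cong₂ hdist fp≡ fa₀≡))
                      (subst (_≤ 1) (sym (hdist-same-line s j p _)) (δ≤1 p _))
      ...   | refl rewrite fp≡ = cong (s [ k ]≔_) (sym (lookup∘update k s b))

    line-relabelling : ∀ j k → (∀ p → f (s [ j ]≔ p) ≡ s [ k ]≔ lookup (f (s [ j ]≔ p)) k) →
      ∀ {u} → u ∈ S → ∀ p → lookup u j ≡ p ⇔ lookup u k ≡ lookup (f (s [ j ]≔ p)) k
    line-relabelling j k on-line {u} u∈S = line-distances⇒relabelling u u s j k g g-inj gsⱼ≡sₖ λ p → begin
      hdist u (s [ j ]≔ p)          ≡⟨ sym (automorphism-isometry φ u _) ⟩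
      hdist (f u) (f (s [ j ]≔ p))  ≡⟨ cong₂ hdist (fixes u u∈S) (on-line p) ⟩
      hdist u (s [ k ]≔ g p)        ∎
      where
      g : Fin M → Fin M
      g p = lookup (f (s [ j ]≔ p)) k
      g-inj : Injective _≡_ _≡_ g
      g-inj {p} {p′} gp≡gp′ = begin
        p                       ≡⟨ sym (lookup∘update j s p) ⟩
        lookup (s [ j ]≔ p) j   ≡⟨ cong (λ y → lookup y j) (f-inj (trans (on-line p)
                                     (trans (cong (s [ k ]≔_) gp≡gp′) (sym (on-line p′))))) ⟩
        lookup (s [ j ]≔ p′) j  ≡⟨ lookup∘update j s p′ ⟩
        p′                      ∎
      gsⱼ≡sₖ : g (lookup s j) ≡ lookup s k
      gsⱼ≡sₖ = cong (λ y → lookup y k) (trans (cong f ([]≔-lookup s j)) fs≡s)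

    line-fixed : ∀ j p → f (s [ j ]≔ p) ≡ s [ j ]≔ p
    line-fixed j p with line-image j
    ... | k , on-line with separates j k (relabelling⇒columns-agree _ (line-relabelling j k on-line))
    ...   | refl = trans (on-line p) (cong (s [ j ]≔_) symbol-fixed)
      where
      gp : Fin M
      gp = lookup (f (s [ j ]≔ p)) j
      relabelled : ∀ {u} → u ∈ S → ∀ p → lookup u j ≡ p ⇔ lookup u j ≡ lookup (f (s [ j ]≔ p)) j
      relabelled = line-relabelling j j on-line
      symbol-fixed : gp ≡ p
      symbol-fixed with gp ≟ p
      ... | yes gp≡p = gp≡p
      ... | no  gp≢p = contradiction (sym (misses≤1 j p gp misses-p misses-gp)) gp≢p
        where
        misses-p : Misses S j p
        misses-p u∈S uⱼ≡p = gp≢p (trans (sym (Equivalence.to (relabelled u∈S p) uⱼ≡p)) uⱼ≡p)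
        misses-gp : Misses S j gp
        misses-gp u∈S uⱼ≡gp = gp≢p (trans (sym uⱼ≡gp) (Equivalence.from (relabelled u∈S p) uⱼ≡gp))

    distances-kept : ∀ x i p → hdist x (s [ i ]≔ p) ≡ hdist (f x) (s [ i ]≔ p)
    distances-kept x i p = begin
      hdist x (s [ i ]≔ p)          ≡⟨ sym (automorphism-isometry φ x _) ⟩
      hdist (f x) (f (s [ i ]≔ p))  ≡⟨ cong (hdist (f x)) (line-fixed i p) ⟩
      hdist (f x) (s [ i ]≔ p)      ∎

-- Necessity of the column conditions

transpose-matchˡ : (a b : Fin m) → PC.transpose a b a ≡ b
transpose-matchˡ a b with a ≟ a
... | yes _   = refl
... | no  a≢a = contradiction refl a≢a

transpose-mismatch : {a b c : Fin m} → c ≢ a → c ≢ b → PC.transpose a b c ≡ c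
transpose-mismatch {a = a} {b} {c} c≢a c≢b with c ≟ a
... | yes c≡a = contradiction c≡a c≢a
... | no  _ with c ≟ b
...   | yes c≡b = contradiction c≡b c≢b
...   | no  _   = refl

permutation-injective : (σ : Permutation′ m) → Injective _≡_ _≡_ (σ ⟨$⟩ʳ_)
permutation-injective σ {x} {y} eq = trans (sym (inverseˡ σ)) (trans (cong (σ ⟨$⟩ˡ_) eq) (inverseˡ σ))

same-kernel⇒permutation : {r : ℕ} (f g : Fin r → Fin m) → SameKernel f g →
  ∃[ σ ] ∀ t → σ ⟨$⟩ʳ f t ≡ g t
same-kernel⇒permutation {r = zero}  f g _ = Perm.id , λ ()
same-kernel⇒permutation {r = suc r} f g kernel
  with same-kernel⇒permutation (f ∘ suc) (g ∘ suc) (λ t t′ → kernel (suc t) (suc t′))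
     | any? (λ t → f (suc t) ≟ f zero)
... | σ , σ-maps | yes (t₀ , f-t₀≡f-0) = σ , maps
  where
  maps : ∀ t → σ ⟨$⟩ʳ f t ≡ g t
  maps zero    = trans (cong (σ ⟨$⟩ʳ_) (sym f-t₀≡f-0))
                       (trans (σ-maps t₀) (Equivalence.to (kernel (suc t₀) zero) f-t₀≡f-0))
  maps (suc t) = σ-maps t
... | σ , σ-maps | no  f-0-new = σ ∘ₚ transpose (σ ⟨$⟩ʳ f zero) (g zero) , maps
  where
  maps : ∀ t → PC.transpose (σ ⟨$⟩ʳ f zero) (g zero) (σ ⟨$⟩ʳ f t) ≡ g t
  maps zero    = transpose-matchˡ (σ ⟨$⟩ʳ f zero) (g zero)
  maps (suc t) = trans (cong (PC.transpose _ _) (σ-maps t)) (transpose-mismatch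
    (λ gₜ≡σf₀ → f-0-new (t , σ-injective (trans (σ-maps t) gₜ≡σf₀)))
    (λ gₜ≡g₀ → f-0-new (t , Equivalence.from (kernel (suc t) zero) gₜ≡g₀)))
    where σ-injective = permutation-injective σ

δ-injective : {h : Fin m → Fin m} → Injective _≡_ _≡_ h → ∀ a b → δ (h a) (h b) ≡ δ a b
δ-injective {h = h} h-inj a b with a ≟ b
... | yes refl = δ-refl (h a)
... | no  a≢b  = δ-≢ (a≢b ∘ h-inj)

isometry⇒automorphism : (f g : Vec (Fin m) n → Vec (Fin m) n) →
  (∀ x → g (f x) ≡ x) → (∀ x → f (g x) ≡ x) → (∀ x y → hdist (f x) (f y) ≡ hdist x y) →
  Automorphism (Hamming m n)
isometry⇒automorphism f g g∘f f∘g isometry = record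
  { fun = f ; inv = g ; inv-l = g∘f ; inv-r = f∘g
  ; adj-iff = λ x y → mk⇔ (trans (isometry x y)) (trans (sym (isometry x y))) }

relabel-at : Fin n → (Fin m → Fin m) → Vec (Fin m) n → Vec (Fin m) n
relabel-at j h x = x [ j ]≔ h (lookup x j)

relabel-at-inverse : (j : Fin n) {h h′ : Fin m → Fin m} → (∀ a → h′ (h a) ≡ a) →
  ∀ x → relabel-at j h′ (relabel-at j h x) ≡ x
relabel-at-inverse j {h} {h′} h′∘h x = begin
  (x [ j ]≔ h (lookup x j)) [ j ]≔ h′ (lookup (x [ j ]≔ h (lookup x j)) j)
    ≡⟨ []≔-idempotent x j ⟩
  x [ j ]≔ h′ (lookup (x [ j ]≔ h (lookup x j)) j)
    ≡⟨ cong (λ a → x [ j ]≔ h′ a) (lookup∘update j x _) ⟩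
  x [ j ]≔ h′ (h (lookup x j))
    ≡⟨ cong (x [ j ]≔_) (h′∘h (lookup x j)) ⟩
  x [ j ]≔ lookup x j
    ≡⟨ []≔-lookup x j ⟩
  x ∎
  where open ≡-Reasoning

relabel-at-isometry : (j : Fin n) {h : Fin m → Fin m} → Injective _≡_ _≡_ h →
  ∀ x y → hdist (relabel-at j h x) (relabel-at j h y) ≡ hdist x y
relabel-at-isometry j {h} h-inj x y = +-cancelʳ-≡ _ _ _ (trans
  (hdist-update x y j (h (lookup x j)) (h (lookup y j)))
  (cong (hdist x y +_) (δ-injective h-inj (lookup x j) (lookup y j))))

symbol-permutation : Fin n → Permutation′ m → Automorphism (Hamming m n)
symbol-permutation j σ = isometry⇒automorphism (relabel-at j (σ ⟨$⟩ʳ_)) (relabel-at j (σ ⟨$⟩ˡ_))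
  (relabel-at-inverse j {σ ⟨$⟩ʳ_} {σ ⟨$⟩ˡ_} (λ _ → inverseˡ σ))
  (relabel-at-inverse j {σ ⟨$⟩ˡ_} {σ ⟨$⟩ʳ_} (λ _ → inverseʳ σ))
  (relabel-at-isometry j (permutation-injective σ))

determining⇒misses≤1 : (S : List (Vec (Fin m) n)) → IsDeterminingSet (Hamming m n) S →
  MissesAtMostOneSymbol S
determining⇒misses≤1 {m = m} {n = n} S determining j a b misses-a misses-b = sym (begin
  b                                  ≡⟨ sym (transpose-matchˡ a b) ⟩
  PC.transpose a b a                 ≡⟨ cong (PC.transpose a b) (sym (lookup-replicate j a)) ⟩
  PC.transpose a b (lookup all-a j)  ≡⟨ sym (lookup∘update j all-a _) ⟩
  lookup (fun swap-ab all-a) j       ≡⟨ cong (λ y → lookup y j) (determining swap-ab fixes-S all-a) ⟩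
  lookup all-a j                     ≡⟨ lookup-replicate j a ⟩
  a                                  ∎)
  where
  open ≡-Reasoning
  all-a : Vec (Fin m) n
  all-a = replicate n a
  swap-ab : Automorphism (Hamming m n)
  swap-ab = symbol-permutation j (transpose a b)
  fixes-S : ∀ v → v ∈ S → fun swap-ab v ≡ v
  fixes-S v v∈S = trans (cong (v [ j ]≔_) (transpose-mismatch (misses-a v∈S) (misses-b v∈S))) ([]≔-lookup v j)

module _ (σ : Permutation′ m) {j k : Fin n} (j≢k : j ≢ k) where

  swap-columns : Vec (Fin m) n → Vec (Fin m) n
  swap-columns x = (x [ j ]≔ (σ ⟨$⟩ˡ lookup x k)) [ k ]≔ (σ ⟨$⟩ʳ lookup x j)

  private
    k≢j : k ≢ j
    k≢j = j≢k ∘ sym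

    lookup-j : ∀ x → lookup (swap-columns x) j ≡ σ ⟨$⟩ˡ lookup x k
    lookup-j x = trans (lookup∘update′ j≢k (x [ j ]≔ (σ ⟨$⟩ˡ lookup x k)) _) (lookup∘update j x _)

    lookup-k : ∀ x → lookup (swap-columns x) k ≡ σ ⟨$⟩ʳ lookup x j
    lookup-k x = lookup∘update k (x [ j ]≔ (σ ⟨$⟩ˡ lookup x k)) _

    lookup-other : ∀ x {i} → i ≢ j → i ≢ k → lookup (swap-columns x) i ≡ lookup x i
    lookup-other x i≢j i≢k =
      trans (lookup∘update′ i≢k (x [ j ]≔ (σ ⟨$⟩ˡ lookup x k)) _) (lookup∘update′ i≢j x _)

  swap-columns-involutive : ∀ x → swap-columns (swap-columns x) ≡ x
  swap-columns-involutive x = vec-ext coordinate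
    where
    coordinate : ∀ i → lookup (swap-columns (swap-columns x)) i ≡ lookup x i
    coordinate i with i ≟ j | i ≟ k
    ... | yes refl | _        = trans (lookup-j (swap-columns x)) (trans (cong (σ ⟨$⟩ˡ_) (lookup-k x)) (inverseˡ σ))
    ... | no  _    | yes refl = trans (lookup-k (swap-columns x)) (trans (cong (σ ⟨$⟩ʳ_) (lookup-j x)) (inverseʳ σ))
    ... | no  i≢j  | no  i≢k  = trans (lookup-other (swap-columns x) i≢j i≢k) (lookup-other x i≢j i≢k)

  swap-columns-isometry : ∀ x y → hdist (swap-columns x) (swap-columns y) ≡ hdist x y
  swap-columns-isometry x y = +-cancelʳ-≡ _ _ _ (begin
    hdist (swap-columns x) (swap-columns y) + δ (lookup x k) (lookup y k)
      ≡⟨ cong (hdist (swap-columns x) (swap-columns y) +_)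
              (cong₂ δ (sym (lookup∘update′ k≢j x _)) (sym (lookup∘update′ k≢j y _))) ⟩
    hdist (swap-columns x) (swap-columns y) + δ (lookup x₁ k) (lookup y₁ k)
      ≡⟨ hdist-update x₁ y₁ k _ _ ⟩
    hdist x₁ y₁ + δ (σ ⟨$⟩ʳ lookup x j) (σ ⟨$⟩ʳ lookup y j)
      ≡⟨ cong (hdist x₁ y₁ +_) (δ-injective (permutation-injective σ) _ _) ⟩
    hdist x₁ y₁ + δ (lookup x j) (lookup y j)
      ≡⟨ hdist-update x y j _ _ ⟩
    hdist x y + δ (σ ⟨$⟩ˡ lookup x k) (σ ⟨$⟩ˡ lookup y k)
      ≡⟨ cong (hdist x y +_) (δ-injective (permutation-injective (Perm.flip σ)) _ _) ⟩
    hdist x y + δ (lookup x k) (lookup y k) ∎)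
    where
    open ≡-Reasoning
    x₁ y₁ : Vec (Fin m) n
    x₁ = x [ j ]≔ (σ ⟨$⟩ˡ lookup x k)
    y₁ = y [ j ]≔ (σ ⟨$⟩ˡ lookup y k)

  column-swap : Automorphism (Hamming m n)
  column-swap = isometry⇒automorphism swap-columns swap-columns
    swap-columns-involutive swap-columns-involutive swap-columns-isometry

  swap-columns-fixes : ∀ x → σ ⟨$⟩ʳ lookup x j ≡ lookup x k → swap-columns x ≡ x
  swap-columns-fixes x σxⱼ≡xₖ = begin
    (x [ j ]≔ (σ ⟨$⟩ˡ lookup x k)) [ k ]≔ (σ ⟨$⟩ʳ lookup x j)
      ≡⟨ cong₂ (λ a b → (x [ j ]≔ a) [ k ]≔ b)
               (trans (cong (σ ⟨$⟩ˡ_) (sym σxⱼ≡xₖ)) (inverseˡ σ)) σxⱼ≡xₖ ⟩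
    (x [ j ]≔ lookup x j) [ k ]≔ lookup x k
      ≡⟨ cong (_[ k ]≔ lookup x k) ([]≔-lookup x j) ⟩
    x [ k ]≔ lookup x k
      ≡⟨ []≔-lookup x k ⟩
    x ∎
    where open ≡-Reasoning

  swap-columns-moves : ∀ x → lookup x k ≢ σ ⟨$⟩ʳ lookup x j → swap-columns x ≢ x
  swap-columns-moves x xₖ≢σxⱼ fx≡x = xₖ≢σxⱼ (trans (cong (λ y → lookup y k) (sym fx≡x)) (lookup-k x))

determining⇒separates : (S : List (Vec (Fin (suc (suc m))) n)) →
  IsDeterminingSet (Hamming (suc (suc m)) n) S → SeparatesColumns S
determining⇒separates {m = m} {n = n} S determining j k agree with j ≟ k
... | yes j≡k = j≡k
... | no  j≢k with same-kernel⇒permutation (column S j) (column S k) (columns-agree⇒same-kernel S agree)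
...   | σ , σ-maps = contradiction (determining (column-swap σ j≢k) fixes-S x₀)
                                   (swap-columns-moves σ j≢k x₀ x₀-moved)
  where
  fixes-S : ∀ v → v ∈ S → swap-columns σ j≢k v ≡ v
  fixes-S v v∈S = swap-columns-fixes σ j≢k v (subst (λ u → σ ⟨$⟩ʳ lookup u j ≡ lookup u k)
                                                      (sym (lookup-index v∈S)) (σ-maps (index v∈S)))
  c : Fin (suc (suc m))
  c = proj₁ (another (σ ⟨$⟩ʳ zero))
  x₀ : Vec (Fin (suc (suc m))) n
  x₀ = replicate n zero [ k ]≔ c
  x₀-moved : lookup x₀ k ≢ σ ⟨$⟩ʳ lookup x₀ j
  x₀-moved x₀ₖ≡σx₀ⱼ = proj₂ (another (σ ⟨$⟩ʳ zero)) (begin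
    c                   ≡⟨ sym (lookup∘update k (replicate n zero) c) ⟩
    lookup x₀ k         ≡⟨ x₀ₖ≡σx₀ⱼ ⟩
    σ ⟨$⟩ʳ lookup x₀ j  ≡⟨ cong (σ ⟨$⟩ʳ_) (trans (lookup∘update′ j≢k (replicate n zero) c)
                                                (lookup-replicate j zero)) ⟩
    σ ⟨$⟩ʳ zero         ∎)
    where open ≡-Reasoning

-- Restricted growth strings

-- Entries are listed newest first: an entry either repeats one of the k labels used after it
-- or is the fresh label k.  Such strings of length s with k labels encode the partitions of an
-- s-set into k blocks.
data IsRGS : ℕ → Vec ℕ s → Set where
  []  : IsRGS 0 []
  old : ∀ {i} {v : Vec ℕ s} → i < k → IsRGS k v → IsRGS k (i ∷ v)
  new : {v : Vec ℕ s} → IsRGS k v → IsRGS (suc k) (k ∷ v)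

rgs-bounded : {v : Vec ℕ s} → IsRGS k v → ∀ t → lookup v t < k
rgs-bounded (old i<k _) zero    = i<k
rgs-bounded (old _ r)   (suc t) = rgs-bounded r t
rgs-bounded (new _)     zero    = n<1+n _
rgs-bounded (new r)     (suc t) = m<n⇒m<1+n (rgs-bounded r t)

rgs-surjective : {v : Vec ℕ s} → IsRGS k v → ∀ i → i < k → ∃[ t ] lookup v t ≡ i
rgs-surjective (old _ r) i i<k with rgs-surjective r i i<k
... | t , vₜ≡i = suc t , vₜ≡i
rgs-surjective {k = suc k} (new r) i i<1+k with i ℕ.≟ k
... | yes refl = zero , refl
... | no  i≢k with rgs-surjective r i (≤∧≢⇒< (s≤s⁻¹ i<1+k) i≢k)
...   | t , vₜ≡i = suc t , vₜ≡i

rgs-labels-unique : {v : Vec ℕ s} → IsRGS k v → IsRGS k′ v → k ≡ k′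
rgs-labels-unique {k = k} {k′} r r′ with <-cmp k k′
... | tri≈ _ k≡k′ _ = k≡k′
... | tri< k<k′ _ _ = let t , vₜ≡k = rgs-surjective r′ k k<k′ in
                      contradiction (subst (_< k) vₜ≡k (rgs-bounded r t)) (<-irrefl refl)
... | tri> _ _ k′<k = let t , vₜ≡k′ = rgs-surjective r k′ k′<k in
                      contradiction (subst (_< k′) vₜ≡k′ (rgs-bounded r′ t)) (<-irrefl refl)

rgs-tail : ∀ {i} {v : Vec ℕ s} → IsRGS k (i ∷ v) → ∃ λ k′ → IsRGS k′ v
rgs-tail (old _ r) = _ , r
rgs-tail (new r)   = _ , r

rgs-head : ∀ {i} {v : Vec ℕ s} → IsRGS k (i ∷ v) → (∃[ t ] lookup v t ≡ i) ⊎ IsRGS i v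
rgs-head (old i<k r) = inj₁ (rgs-surjective r _ i<k)
rgs-head (new r)     = inj₂ r

rgs-canonical : {v w : Vec ℕ s} → IsRGS k v → IsRGS k′ w → SameKernel (lookup v) (lookup w) → v ≡ w
rgs-canonical {v = []} {[]} _ _ _ = refl
rgs-canonical {v = i ∷ v} {j ∷ w} r r′ kernel
  with rgs-canonical (proj₂ (rgs-tail r)) (proj₂ (rgs-tail r′)) (λ t t′ → kernel (suc t) (suc t′))
... | refl = cong (_∷ v) (same-head (rgs-head r) (rgs-head r′))
  where
  same-head : (∃[ t ] lookup v t ≡ i) ⊎ IsRGS i v → (∃[ t ] lookup v t ≡ j) ⊎ IsRGS j v → i ≡ j
  same-head (inj₁ (t , vₜ≡i)) _ = trans (sym vₜ≡i) (sym (Equivalence.to (kernel zero (suc t)) (sym vₜ≡i)))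
  same-head _ (inj₁ (t , vₜ≡j)) = trans (Equivalence.from (kernel zero (suc t)) (sym vₜ≡j)) vₜ≡j
  same-head (inj₂ rᵢ) (inj₂ rⱼ) = rgs-labels-unique rᵢ rⱼ

prepend-each : ℕ → List (Vec ℕ s) → List (Vec ℕ (suc s))
prepend-each k []       = []
prepend-each k (v ∷ vs) = map (_∷ v) (downFrom k) ++ prepend-each k vs

rgs : (s k : ℕ) → List (Vec ℕ s)
rgs zero    zero    = [] ∷ []
rgs zero    (suc k) = []
rgs (suc s) zero    = []
rgs (suc s) (suc k) = prepend-each (suc k) (rgs s (suc k)) ++ map (k ∷_) (rgs s k)

length-prepend-each : (k : ℕ) (vs : List (Vec ℕ s)) → length (prepend-each k vs) ≡ k * length vs
length-prepend-each k []       = sym (*-zeroʳ k)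
length-prepend-each k (v ∷ vs) = begin
  length (map (_∷ v) (downFrom k) ++ prepend-each k vs)     ≡⟨ length-++ (map (_∷ v) (downFrom k)) ⟩
  length (map (_∷ v) (downFrom k)) + length (prepend-each k vs)
    ≡⟨ cong₂ _+_ (trans (length-map (_∷ v) (downFrom k)) (length-downFrom k)) (length-prepend-each k vs) ⟩
  k + k * length vs                                         ≡⟨ sym (*-suc k (length vs)) ⟩
  k * suc (length vs)                                       ∎
  where open ≡-Reasoning

length-rgs : ∀ s k → length (rgs s k) ≡ Stirling2 s k
length-rgs zero    zero    = refl
length-rgs zero    (suc k) = refl
length-rgs (suc s) zero    = refl
length-rgs (suc s) (suc k) = begin
  length (prepend-each (suc k) (rgs s (suc k)) ++ map (k ∷_) (rgs s k))
    ≡⟨ length-++ (prepend-each (suc k) (rgs s (suc k))) ⟩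
  length (prepend-each (suc k) (rgs s (suc k))) + length (map (k ∷_) (rgs s k))
    ≡⟨ cong₂ _+_ (length-prepend-each (suc k) (rgs s (suc k))) (length-map (k ∷_) (rgs s k)) ⟩
  suc k * length (rgs s (suc k)) + length (rgs s k)
    ≡⟨ cong₂ (λ a b → suc k * a + b) (length-rgs s (suc k)) (length-rgs s k) ⟩
  suc k * Stirling2 s (suc k) + Stirling2 s k ∎
  where open ≡-Reasoning

∈-prepend-each⁺ : ∀ {i} {v : Vec ℕ s} {vs} → i < k → v ∈ vs → i ∷ v ∈ prepend-each k vs
∈-prepend-each⁺ {k = k} {vs = v ∷ vs} i<k (here refl) = ∈-++⁺ˡ (∈-map⁺ (_∷ v) (∈-downFrom⁺ i<k))
∈-prepend-each⁺ {k = k} {vs = w ∷ vs} i<k (there v∈vs) =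
  ∈-++⁺ʳ (map (_∷ w) (downFrom k)) (∈-prepend-each⁺ i<k v∈vs)

∈-prepend-each⁻ : ∀ {i} {v : Vec ℕ s} vs → i ∷ v ∈ prepend-each k vs → i < k × v ∈ vs
∈-prepend-each⁻ {k = k} (w ∷ vs) i∷v∈ with ∈-++⁻ (map (_∷ w) (downFrom k)) i∷v∈
... | inj₁ ∈heads = let i′ , i′∈ , i∷v≡ = ∈-map⁻ (_∷ w) ∈heads in
  subst (_< k) (sym (∷-injectiveˡ i∷v≡)) (∈-downFrom⁻ i′∈) , here (∷-injectiveʳ i∷v≡)
... | inj₂ ∈rest = let i<k , v∈vs = ∈-prepend-each⁻ vs ∈rest in i<k , there v∈vs

rgs-complete : {v : Vec ℕ s} → IsRGS k v → v ∈ rgs s k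
rgs-complete []                        = here refl
rgs-complete {k = suc k} (old i<k r)   = ∈-++⁺ˡ (∈-prepend-each⁺ i<k (rgs-complete r))
rgs-complete {s = suc s} (new {k = k} r) =
  ∈-++⁺ʳ (prepend-each (suc k) (rgs s (suc k))) (∈-map⁺ (k ∷_) (rgs-complete r))

rgs-sound : ∀ s k {v : Vec ℕ s} → v ∈ rgs s k → IsRGS k v
rgs-sound zero    zero    {[]}    (here refl) = []
rgs-sound (suc s) (suc k) {i ∷ v} v∈ with ∈-++⁻ (prepend-each (suc k) (rgs s (suc k))) v∈
... | inj₁ ∈old = let i<k , v∈ = ∈-prepend-each⁻ (rgs s (suc k)) ∈old in old i<k (rgs-sound s (suc k) v∈)
... | inj₂ ∈new with ∈-map⁻ (k ∷_) ∈new
...   | v′ , v′∈ , refl = new (rgs-sound s k v′∈)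

prepend-each-unique : (k : ℕ) {vs : List (Vec ℕ s)} → Unique vs → Unique (prepend-each k vs)
prepend-each-unique k {[]}     []            = []
prepend-each-unique k {v ∷ vs} (v∉vs ∷ uniq) =
  Unique.++⁺ (Unique.map⁺ ∷-injectiveˡ (Unique.downFrom⁺ k)) (prepend-each-unique k uniq) disjoint
  where
  disjoint : ∀ {w} → ¬ (w ∈ map (_∷ v) (downFrom k) × w ∈ prepend-each k vs)
  disjoint (w∈heads , w∈rest) with ∈-map⁻ (_∷ v) w∈heads
  ... | i , _ , refl = All.lookup v∉vs (proj₂ (∈-prepend-each⁻ vs w∈rest)) refl

rgs-unique : ∀ s k → Unique (rgs s k)
rgs-unique zero    zero    = All.[] ∷ []
rgs-unique zero    (suc k) = []
rgs-unique (suc s) zero    = []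
rgs-unique (suc s) (suc k) = Unique.++⁺
  (prepend-each-unique (suc k) (rgs-unique s (suc k)))
  (Unique.map⁺ ∷-injectiveʳ (rgs-unique s k))
  disjoint
  where
  disjoint : ∀ {w} → ¬ (w ∈ prepend-each (suc k) (rgs s (suc k)) × w ∈ map (k ∷_) (rgs s k))
  disjoint (w∈old , w∈new) with ∈-map⁻ (k ∷_) w∈new
  ... | v , v∈ , refl = contradiction
    (rgs-labels-unique (rgs-sound s (suc k) (proj₂ (∈-prepend-each⁻ (rgs s (suc k)) w∈old))) (rgs-sound s k v∈))
    (λ 1+k≡k → <-irrefl (sym 1+k≡k) (n<1+n k))

same-kernel-∷ : {A : Set} {c : Fin (suc s) → A} {e : ℕ} {v : Vec ℕ s} →
  SameKernel (c ∘ suc) (lookup v) → (∀ t → c zero ≡ c (suc t) ⇔ e ≡ lookup v t) →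
  SameKernel c (lookup (e ∷ v))
same-kernel-∷ tail head zero    zero     = mk⇔ (λ _ → refl) (λ _ → refl)
same-kernel-∷ tail head zero    (suc t′) = head t′
same-kernel-∷ tail head (suc t) zero     =
  mk⇔ (sym ∘ Equivalence.to (head t) ∘ sym) (sym ∘ Equivalence.from (head t) ∘ sym)
same-kernel-∷ tail head (suc t) (suc t′) = tail t t′

rgs-of : {A : Set} → DecidableEquality A → (c : Fin s → A) →
  ∃[ k ] ∃[ v ] IsRGS k v × SameKernel c (lookup v)
rgs-of {s = zero}  _≟ᴬ_ c = 0 , [] , [] , λ ()
rgs-of {s = suc s} _≟ᴬ_ c with rgs-of _≟ᴬ_ (c ∘ suc) | any? (λ t → c (suc t) ≟ᴬ c zero)
... | k , v , r , kernel | yes (t₀ , c-t₀≡c-0) =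
  k , lookup v t₀ ∷ v , old (rgs-bounded r t₀) r , same-kernel-∷ kernel λ t → mk⇔
    (λ c-0≡c-t → Equivalence.to (kernel t₀ t) (trans c-t₀≡c-0 c-0≡c-t))
    (λ vₜ₀≡vₜ → trans (sym c-t₀≡c-0) (Equivalence.from (kernel t₀ t) vₜ₀≡vₜ))
... | k , v , r , kernel | no  c-0-fresh =
  suc k , k ∷ v , new r , same-kernel-∷ kernel λ t → mk⇔
    (λ c-0≡c-t → contradiction (t , sym c-0≡c-t) c-0-fresh)
    (λ k≡vₜ → contradiction (subst (_< k) (sym k≡vₜ) (rgs-bounded r t)) (<-irrefl refl))

rgs-labels≤symbols : {m : ℕ} {c : Fin s → Fin m} {v : Vec ℕ s} →
  IsRGS k v → SameKernel c (lookup v) → k ≤ m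
rgs-labels≤symbols {s = s} {k = k} {c = c} r kernel = injective⇒≤ {f = c ∘ representative} λ {i} {i′} eq →
  toℕ-injective (trans (sym (proj₂ (rgs-surjective r _ (toℕ<n i))))
    (trans (Equivalence.to (kernel _ _) eq) (proj₂ (rgs-surjective r _ (toℕ<n i′)))))
  where
  representative : Fin k → Fin s
  representative i = proj₁ (rgs-surjective r (toℕ i) (toℕ<n i))

present-symbols≤rgs-labels : {m p : ℕ} {c : Fin s → Fin m} {v : Vec ℕ s} →
  IsRGS k v → SameKernel c (lookup v) →
  (h : Fin p → Fin m) → Injective _≡_ _≡_ h → (∀ i → ∃[ t ] c t ≡ h i) → p ≤ k
present-symbols≤rgs-labels {k = k} {p = p} r kernel h h-inj present = injective⇒≤ {f = label} λ {i} {i′} eq →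
  h-inj (trans (sym (proj₂ (present i))) (trans (Equivalence.from (kernel _ _)
    (trans (sym (toℕ-fromℕ< (rgs-bounded r _))) (trans (cong toℕ eq) (toℕ-fromℕ< (rgs-bounded r _)))))
    (proj₂ (present i′))))
  where
  label : Fin p → Fin k
  label i = fromℕ< (rgs-bounded r (proj₁ (present i)))

misses≤1⇒symbols≤1+rgs-labels : {m : ℕ} {c : Fin s → Fin (suc m)} {v : Vec ℕ s} →
  IsRGS k v → SameKernel c (lookup v) →
  (∀ a b → (∀ t → c t ≢ a) → (∀ t → c t ≢ b) → a ≡ b) → m ≤ k
misses≤1⇒symbols≤1+rgs-labels {m = m} {c} r kernel misses≤1
  with any? (λ a → ¬? (any? (λ t → c t ≟ a)))
... | yes (a₀ , a₀-absent) = present-symbols≤rgs-labels r kernel (punchIn a₀) (punchIn-injective a₀ _ _) present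
  where
  present : ∀ i → ∃[ t ] c t ≡ punchIn a₀ i
  present i with any? (λ t → c t ≟ punchIn a₀ i)
  ... | yes found  = found
  ... | no  absent = contradiction
    (misses≤1 _ _ (λ t cₜ≡ → absent (t , cₜ≡)) (λ t cₜ≡ → a₀-absent (t , cₜ≡))) (punchInᵢ≢i a₀ i)
... | no all-present = ≤-trans (n≤1+n m) (present-symbols≤rgs-labels r kernel id id present)
  where
  present : ∀ a → ∃[ t ] c t ≡ a
  present a with any? (λ t → c t ≟ a)
  ... | yes found  = found
  ... | no  absent = contradiction (a , absent) all-present

-- Counting columns

column-pattern : (S : List (Vec (Fin (suc (suc m))) n)) → MissesAtMostOneSymbol S → ∀ j →
  ∃[ v ] v ∈ rgs (length S) (suc (suc m)) ++ rgs (length S) (suc m) × SameKernel (column S j) (lookup v)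
column-pattern {m = m} S misses≤1 j with rgs-of _≟_ (column S j)
... | k , v , rgsₖ , kernel with m≤n⇒m<n∨m≡n (rgs-labels≤symbols rgsₖ kernel)
...   | inj₂ refl = v , ∈-++⁺ˡ (rgs-complete rgsₖ) , kernel
...   | inj₁ k<2+m = v , ∈-++⁺ʳ (rgs (length S) (suc (suc m)))
    (subst (λ k → v ∈ rgs (length S) k) k≡1+m (rgs-complete rgsₖ)) , kernel
  where
  k≡1+m : k ≡ suc m
  k≡1+m = ≤-antisym (s≤s⁻¹ k<2+m)
    (misses≤1⇒symbols≤1+rgs-labels rgsₖ kernel (misses≤1⇒column-misses≤1 S misses≤1 j))

columns≤stirling : (S : List (Vec (Fin (suc (suc m))) n)) → SeparatesColumns S → MissesAtMostOneSymbol S →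
  n ≤ Stirling2 (length S) (suc (suc m)) + Stirling2 (length S) (suc m)
columns≤stirling {m = m} {n} S separates misses≤1 = begin
  n         ≤⟨ injective⇒≤ {f = index ∘ code∈} code-position-injective ⟩
  length X  ≡⟨ length-++ (rgs r (suc (suc m))) ⟩
  length (rgs r (suc (suc m))) + length (rgs r (suc m))
            ≡⟨ cong₂ _+_ (length-rgs r (suc (suc m))) (length-rgs r (suc m)) ⟩
  Stirling2 r (suc (suc m)) + Stirling2 r (suc m) ∎
  where
  open ≤-Reasoning
  r : ℕ
  r = length S
  X : List (Vec ℕ r)
  X = rgs r (suc (suc m)) ++ rgs r (suc m)
  code : Fin n → Vec ℕ r
  code j = proj₁ (column-pattern S misses≤1 j)
  code∈ : ∀ j → code j ∈ X
  code∈ j = proj₁ (proj₂ (column-pattern S misses≤1 j))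
  kernel : ∀ j → SameKernel (column S j) (lookup (code j))
  kernel j = proj₂ (proj₂ (column-pattern S misses≤1 j))
  code-injective : ∀ {j k} → code j ≡ code k → j ≡ k
  code-injective {j} {k} pⱼ≡pₖ = separates j k (same-kernel⇒columns-agree S
    (same-kernel-trans (kernel j) (subst (λ v → SameKernel (lookup v) (column S k)) (sym pⱼ≡pₖ)
      (same-kernel-sym (kernel k)))))
  code-position-injective : ∀ {j k} → index (code∈ j) ≡ index (code∈ k) → j ≡ k
  code-position-injective {j} {k} eq = code-injective
    (trans (lookup-index (code∈ j)) (trans (cong (List.lookup X) eq) (sym (lookup-index (code∈ k)))))

-- A determining set of size r

unique-lookup-injective : {A : Set} {xs : List A} → Unique xs →
  ∀ i j → List.lookup xs i ≡ List.lookup xs j → i ≡ j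
unique-lookup-injective (x∉xs ∷ uniq) zero    zero    _  = refl
unique-lookup-injective (x∉xs ∷ uniq) zero    (suc j) eq = contradiction eq (All.lookup x∉xs (∈-lookup j))
unique-lookup-injective (x∉xs ∷ uniq) (suc i) zero    eq = contradiction (sym eq) (All.lookup x∉xs (∈-lookup i))
unique-lookup-injective (x∉xs ∷ uniq) (suc i) (suc j) eq = cong suc (unique-lookup-injective uniq i j eq)

module Construction {m n : ℕ} (r : ℕ) (n≤ : n ≤ Stirling2 r (suc (suc m)) + Stirling2 r (suc m)) where

  private
    M : ℕ
    M = suc (suc m)
    X : List (Vec ℕ r)
    X = rgs r M ++ rgs r (suc m)

    X-unique : Unique X
    X-unique = Unique.++⁺ (rgs-unique r M) (rgs-unique r (suc m)) λ (v∈ , v∈′) →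
      <-irrefl (sym (rgs-labels-unique (rgs-sound r M v∈) (rgs-sound r (suc m) v∈′))) (n<1+n (suc m))

    n≤|X| : n ≤ length X
    n≤|X| = subst (n ≤_)
      (sym (trans (length-++ (rgs r M)) (cong₂ _+_ (length-rgs r M) (length-rgs r (suc m))))) n≤

    word : Fin n → Vec ℕ r
    word j = List.lookup X (inject≤ j n≤|X|)

    word-injective : ∀ {j k} → word j ≡ word k → j ≡ k
    word-injective eq = inject≤-injective n≤|X| n≤|X| _ _ (unique-lookup-injective X-unique _ _ eq)

    word-labels : ∀ j → ∃[ k ] IsRGS k (word j) × suc m ≤ k × k ≤ M
    word-labels j with ∈-++⁻ (rgs r M) (∈-lookup {xs = X} (inject≤ j n≤|X|))
    ... | inj₁ w∈ = M , rgs-sound r M w∈ , n≤1+n (suc m) , ≤-refl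
    ... | inj₂ w∈ = suc m , rgs-sound r (suc m) w∈ , ≤-refl , n≤1+n (suc m)

    word-rgs : ∀ j → IsRGS (proj₁ (word-labels j)) (word j)
    word-rgs j = proj₁ (proj₂ (word-labels j))

    entry : Fin n → Fin r → Fin M
    entry j t = fromℕ< (≤-trans (rgs-bounded (word-rgs j) t) (proj₂ (proj₂ (proj₂ (word-labels j)))))

    row : Fin r → Vec (Fin M) n
    row t = tabulate λ j → entry j t

  -- Rows may repeat; minimality of r shows afterwards that no repetition occurs.
  S : List (Vec (Fin M) n)
  S = deduplicate (≡-dec _≟_) (List.tabulate row)

  S-unique : Unique S
  S-unique = DecUnique.deduplicate-! (≡-dec _≟_) (List.tabulate row)

  |S|≤r : length S ≤ r
  |S|≤r = ≤-trans (length-deduplicate (≡-dec _≟_) (List.tabulate row)) (≤-reflexive (length-tabulate row))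

  private
    row∈S : ∀ t → row t ∈ S
    row∈S t = ∈-deduplicate⁺ (≡-dec _≟_) (∈-tabulate⁺ t)

    toℕ-row : ∀ t j → toℕ (lookup (row t) j) ≡ lookup (word j) t
    toℕ-row t j = trans (cong toℕ (lookup∘tabulate (λ j → entry j t) j)) (toℕ-fromℕ< _)

    columns-agree⇒words-kernel : ∀ {j k} → ColumnsAgree S j k → SameKernel (lookup (word j)) (lookup (word k))
    columns-agree⇒words-kernel {j} {k} agree t t′ = mk⇔
      (λ eq → through k (Equivalence.to (agree (row∈S t) (row∈S t′)) (back j eq)))
      (λ eq → through j (Equivalence.from (agree (row∈S t) (row∈S t′)) (back k eq)))
      where
      back : ∀ i → lookup (word i) t ≡ lookup (word i) t′ → lookup (row t) i ≡ lookup (row t′) i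
      back i eq = toℕ-injective (trans (toℕ-row t i) (trans eq (sym (toℕ-row t′ i))))
      through : ∀ i → lookup (row t) i ≡ lookup (row t′) i → lookup (word i) t ≡ lookup (word i) t′
      through i eq = trans (sym (toℕ-row t i)) (trans (cong toℕ eq) (toℕ-row t′ i))

    misses⇒last : ∀ {j a} → Misses S j a → toℕ a ≡ suc m
    misses⇒last {j} {a} misses with word-labels j
    ... | k , word-rgsⱼ , 1+m≤k , _ = ≤-antisym (s≤s⁻¹ (toℕ<n a)) (≤-trans 1+m≤k k≤a)
      where
      k≤a : k ≤ toℕ a
      k≤a with toℕ a <? k
      ... | no  a≮k = ≮⇒≥ a≮k
      ... | yes a<k = let t , wₜ≡a = rgs-surjective word-rgsⱼ (toℕ a) a<k in
        contradiction (toℕ-injective (trans (toℕ-row t j) wₜ≡a)) (misses (row∈S t))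

  S-separates : SeparatesColumns S
  S-separates j k agree = word-injective (rgs-canonical (word-rgs j) (word-rgs k) (columns-agree⇒words-kernel agree))

  S-misses≤1 : MissesAtMostOneSymbol S
  S-misses≤1 j a b misses-a misses-b = toℕ-injective (trans (misses⇒last misses-a) (sym (misses⇒last misses-b)))

  S-determining : 0 < r → IsDeterminingSet (Hamming M n) S
  S-determining 0<r = separating⇒determining (row∈S (fromℕ< 0<r)) S-separates S-misses≤1

positive-stirling-sum⇒positive : ∀ {m} r → 0 < Stirling2 r (suc (suc m)) + Stirling2 r (suc m) → 0 < r
positive-stirling-sum⇒positive zero    ()
positive-stirling-sum⇒positive (suc r) _  = s≤s z≤n

theorem4p1 : (m n : ℕ) → 2 ≤ m → 1 ≤ n → (r : ℕ)
    → n ≤ Stirling2 r m + Stirling2 r (m ∸ 1)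
    → ((r′ : ℕ) → r′ < r → ¬ (n ≤ Stirling2 r′ m + Stirling2 r′ (m ∸ 1)))
    → IsDeterminingNumber (Hamming m n) r
theorem4p1 (suc (suc m)) n (s≤s (s≤s z≤n)) 1≤n r n≤stirling below =
  (S , S-unique , determining , ≤-antisym |S|≤r (minimal S S-unique determining)) , minimal
  where
  open Construction r n≤stirling
  determining : IsDeterminingSet (Hamming (suc (suc m)) n) S
  determining = S-determining (positive-stirling-sum⇒positive r (≤-trans 1≤n n≤stirling))
  minimal : (S′ : List (Vertex (Hamming (suc (suc m)) n))) → Unique S′ →
    IsDeterminingSet (Hamming (suc (suc m)) n) S′ → r ≤ length S′
  minimal S′ _ determining′ with length S′ <? r
  ... | no  ≮r = ≮⇒≥ ≮r
  ... | yes <r = contradiction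
    (columns≤stirling S′ (determining⇒separates S′ determining′) (determining⇒misses≤1 S′ determining′))
    (below (length S′) <r)
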